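{- If $\ast$ is an ergodic operation on a finite set $\mathcal{X}$, then every periodic partition of $(\mathcal{X},\ast)$ is stable.
   Context: $\ast$ is uniformity preserving if each map $x\mapsto x\ast b$ is bijective; ergodic if moreover there is $l>0$ such that for all $a,b\in\mathcal{X}$ there are $x_0,\dots,x_{l-1}$ with $(\cdots((a\ast x_0)\ast x_1)\cdots)\ast x_{l-1}=b$. For $A,B\subset\mathcal{X}$, $A\ast B=\{a\ast b\}$; for a set $\mathcal{H}$ of subsets, $\mathcal{H}^{\ast}=\{A\ast B:A,B\in\mathcal{H}\}$, $\mathcal{H}^{0\ast}=\mathcal{H}$, $\mathcal{H}^{n\ast}=(\mathcal{H}^{(n-1)\ast})^{\ast}$. A partition $\mathcal{H}$ is periodic if $\mathcal{H}^{n\ast}=\mathcal{H}$ for some $n>0$, balanced if all its blocks have the same size, and stable if balanced and periodic. -}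

module Defs where

open import Data.Nat using (ℕ; zero; suc; _<_)
open import Data.Fin using (Fin)
open import Data.Fin.Properties using (any?; _≟_)
open import Data.Fin.Subset using (Subset; _∈_; _∩_; ∣_∣; Nonempty; Empty)
open import Data.Fin.Subset.Properties using (_∈?_)
open import Data.Vec using (tabulate)
open import Data.List using (List; []; _∷_; length)
open import Data.Product using (Σ; ∃; _×_; _,_)
open import Relation.Nullary using (¬_)
open import Relation.Nullary.Decidable using (⌊_⌋; _×-dec_)
open import Relation.Binary.PropositionalEquality using (_≡_; _≢_)
open import Function.Definitions using (Bijective)
open import Function.Bundles using (_⇔_)

Op : ℕ → Set
Op n = Fin n → Fin n → Fin n

UniformityPreserving : ∀ {n} → Op n → Set
UniformityPreserving {n} _∗_ = ∀ (b : Fin n) → Bijective _≡_ _≡_ (λ x → x ∗ b)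

applySeq : ∀ {n} → Op n → Fin n → List (Fin n) → Fin n
applySeq _∗_ a []       = a
applySeq _∗_ a (x ∷ xs) = applySeq _∗_ (a ∗ x) xs

Ergodic : ∀ {n} → Op n → Set
Ergodic {n} _∗_ =
  UniformityPreserving _∗_ ×
  (Σ ℕ λ l → 0 < l × (∀ (a b : Fin n) →
     Σ (List (Fin n)) λ xs → length xs ≡ l × applySeq _∗_ a xs ≡ b))

setOp : ∀ {n} → Op n → Subset n → Subset n → Subset n
setOp _∗_ A B = tabulate λ x →
  ⌊ any? (λ a → any? (λ b → (a ∈? A ×-dec b ∈? B) ×-dec (a ∗ b ≟ x))) ⌋

Family : ℕ → Set₁
Family n = Subset n → Set

starFam : ∀ {n} → Op n → Family n → Family n
starFam _∗_ H C = ∃ λ A → ∃ λ B → H A × H B × C ≡ setOp _∗_ A B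

iterStar : ∀ {n} → Op n → ℕ → Family n → Family n
iterStar _∗_ zero    H = H
iterStar _∗_ (suc k) H = starFam _∗_ (iterStar _∗_ k H)

IsPartition : ∀ {n} → Family n → Set
IsPartition {n} H =
  (∀ A → H A → Nonempty A) ×
  (∀ A B → H A → H B → A ≢ B → Empty (A ∩ B)) ×
  (∀ (x : Fin n) → ∃ λ A → H A × x ∈ A)

SameFamily : ∀ {n} → Family n → Family n → Set
SameFamily H K = ∀ C → H C ⇔ K C

Periodic : ∀ {n} → Op n → Family n → Set
Periodic _∗_ H = Σ ℕ λ k → 0 < k × SameFamily (iterStar _∗_ k H) H

Balanced : ∀ {n} → Family n → Set
Balanced H = ∀ A B → H A → H B → ∣ A ∣ ≡ ∣ B ∣

Stable : ∀ {n} → Op n → Family n → Set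
Stable _∗_ H = Balanced H × Periodic _∗_ H

module Submission where

open import Defs
open import Data.Nat using (ℕ; zero; suc; _+_; _*_; _≤_)
open import Data.Nat.Properties using (≤-refl; ≤-trans; ≤-antisym; +-suc; +-identityʳ; *-comm)
open import Data.Fin using (Fin; zero; suc)
open import Data.Fin.Properties using (suc-injective; injective⇒≤)
open import Data.Fin.Subset using (Subset; _∈_; ∣_∣; inside; outside)
open import Data.Fin.Subset.Properties using (x∈p∩q⁺)
open import Data.Vec using (_∷_; here; there)
open import Data.Vec.Properties using (lookup∘tabulate; lookup⇒[]=; ≡-dec)
open import Data.Bool using () renaming (_≟_ to _≟ᵇ_)
open import Data.Bool.Properties using (T-≡)
open import Data.List using (List; []; _∷_; length; _++_)
open import Data.List.Properties using (length-++)
open import Data.Product using (Σ; ∃; _×_; _,_; proj₁; proj₂)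
open import Relation.Nullary using (yes; no; contradiction)
open import Relation.Nullary.Decidable using (fromWitness)
open import Relation.Binary.PropositionalEquality
open import Function.Base using (_∘_)
open import Function.Bundles using (Equivalence)
open import Function.Definitions using (Injective; Surjective)

-- Pick a ∈ A and c ∈ C for two blocks of ℋ. By ergodicity some word xs of
-- length divisible by the period k leads from a to c. Following the word, the
-- block P ∈ ℋ^{j∗} containing the current point is replaced by P ∗ R with R a
-- block of ℋ^{j∗} containing the next letter x; since z ↦ z ∗ x is injective,
-- |P| ≤ |P ∗ R|. (Each ℋ^{j∗} covers 𝒳, as x = y ∗ x for some y.) At the end we reach a block of ℋ^{(mk)∗} = ℋ containing c,
-- which must be C; hence |A| ≤ |C|, and by symmetry |A| = |C|.

enumerate : ∀ {n} (p : Subset n) → Fin ∣ p ∣ → Fin n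
enumerate (inside  ∷ p) zero    = zero
enumerate (inside  ∷ p) (suc i) = suc (enumerate p i)
enumerate (outside ∷ p) i       = suc (enumerate p i)

enumerate-injective : ∀ {n} (p : Subset n) → Injective _≡_ _≡_ (enumerate p)
enumerate-injective (inside ∷ p)  {zero}  {zero}  _ = refl
enumerate-injective (inside ∷ p)  {suc i} {suc j} e =
  cong suc (enumerate-injective p (suc-injective e))
enumerate-injective (outside ∷ p) e = enumerate-injective p (suc-injective e)

enumerate-∈ : ∀ {n} (p : Subset n) i → enumerate p i ∈ p
enumerate-∈ (inside  ∷ p) zero    = here
enumerate-∈ (inside  ∷ p) (suc i) = there (enumerate-∈ p i)
enumerate-∈ (outside ∷ p) i       = there (enumerate-∈ p i)

rank : ∀ {n} (p : Subset n) (x : Fin n) → x ∈ p → Fin ∣ p ∣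
rank (inside  ∷ p) zero    here       = zero
rank (inside  ∷ p) (suc x) (there x∈p) = suc (rank p x x∈p)
rank (outside ∷ p) (suc x) (there x∈p) = rank p x x∈p

rank-injective : ∀ {n} (p : Subset n) x y (x∈p : x ∈ p) (y∈p : y ∈ p) →
                 rank p x x∈p ≡ rank p y y∈p → x ≡ y
rank-injective (inside  ∷ p) zero    zero    here        here        _ = refl
rank-injective (inside  ∷ p) (suc x) (suc y) (there x∈p) (there y∈p) e =
  cong suc (rank-injective p x y x∈p y∈p (suc-injective e))
rank-injective (outside ∷ p) (suc x) (suc y) (there x∈p) (there y∈p) e =
  cong suc (rank-injective p x y x∈p y∈p e)

injective⇒∣p∣≤∣q∣ : ∀ {n} (p q : Subset n) {f : Fin n → Fin n} → Injective _≡_ _≡_ f →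
                    (∀ x → x ∈ p → f x ∈ q) → ∣ p ∣ ≤ ∣ q ∣
injective⇒∣p∣≤∣q∣ p q {f} f-inj f[p]⊆q = injective⇒≤ {f = g} g-inj
  where
  g : Fin ∣ p ∣ → Fin ∣ q ∣
  g i = rank q (f (enumerate p i)) (f[p]⊆q _ (enumerate-∈ p i))

  g-inj : Injective _≡_ _≡_ g
  g-inj e = enumerate-injective p (f-inj (rank-injective q _ _ _ _ e))

_⊆ᶠ_ : ∀ {n} → Family n → Family n → Set
F ⊆ᶠ G = ∀ C → F C → G C

Covers : ∀ {n} → Family n → Set
Covers {n} F = ∀ (x : Fin n) → ∃ λ A → F A × x ∈ A

partition-blocks-unique : ∀ {n} {H : Family n} → IsPartition H →
                          ∀ {A B x} → H A → H B → x ∈ A → x ∈ B → A ≡ B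
partition-blocks-unique (_ , disjoint , _) {A} {B} {x} hA hB x∈A x∈B
  with ≡-dec _≟ᵇ_ A B
... | yes A≡B = A≡B
... | no  A≢B = contradiction (x , x∈p∩q⁺ (x∈A , x∈B)) (disjoint A B hA hB A≢B)

module _ {n} (_∗_ : Op n) where

  ∈-setOp : ∀ {A B x y} → x ∈ A → y ∈ B → x ∗ y ∈ setOp _∗_ A B
  ∈-setOp {A} {B} {x} {y} x∈A y∈B = lookup⇒[]= (x ∗ y) _
    (trans (lookup∘tabulate _ (x ∗ y))
           (Equivalence.to T-≡ (fromWitness (x , y , (x∈A , y∈B) , refl))))

  ∣p∣≤∣p∗q∣ : ∀ {P Q x} → Injective _≡_ _≡_ (_∗ x) → x ∈ Q → ∣ P ∣ ≤ ∣ setOp _∗_ P Q ∣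
  ∣p∣≤∣p∗q∣ {P} {Q} ∗x-inj x∈Q =
    injective⇒∣p∣≤∣q∣ P (setOp _∗_ P Q) ∗x-inj (λ _ z∈P → ∈-setOp z∈P x∈Q)

  starFam-mono : ∀ {F G} → F ⊆ᶠ G → starFam _∗_ F ⊆ᶠ starFam _∗_ G
  starFam-mono F⊆G C (A , B , fA , fB , C≡A∗B) = A , B , F⊆G A fA , F⊆G B fB , C≡A∗B

  iterStar-mono : ∀ j {F G} → F ⊆ᶠ G → iterStar _∗_ j F ⊆ᶠ iterStar _∗_ j G
  iterStar-mono zero    F⊆G = F⊆G
  iterStar-mono (suc j) F⊆G = starFam-mono (iterStar-mono j F⊆G)

  iterStar-+ : ∀ i j F → iterStar _∗_ (i + j) F ⊆ᶠ iterStar _∗_ i (iterStar _∗_ j F)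
  iterStar-+ zero    j F _ h = h
  iterStar-+ (suc i) j F     = starFam-mono (iterStar-+ i j F)

  iterStar-multiple : ∀ {k H} → iterStar _∗_ k H ⊆ᶠ H → ∀ m → iterStar _∗_ (m * k) H ⊆ᶠ H
  iterStar-multiple         _  zero    _ h = h
  iterStar-multiple {k} {H} Hᵏ⊆H (suc m) C h =
    Hᵏ⊆H C (iterStar-mono k (iterStar-multiple Hᵏ⊆H m) C (iterStar-+ k (m * k) H C h))

  covers-starFam : (∀ b → Surjective _≡_ _≡_ (_∗ b)) → ∀ {F} → Covers F → Covers (starFam _∗_ F)
  covers-starFam surj cov x with surj x x
  ... | y , y∗x≡x with cov y | cov x
  ... | Y , hY , y∈Y | X , hX , x∈X =
    setOp _∗_ Y X , (Y , X , hY , hX , refl) , subst (_∈ setOp _∗_ Y X) (y∗x≡x refl) (∈-setOp y∈Y x∈X)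

  covers-iterStar : (∀ b → Surjective _≡_ _≡_ (_∗ b)) → ∀ {F} → Covers F → ∀ j → Covers (iterStar _∗_ j F)
  covers-iterStar surj cov zero    = cov
  covers-iterStar surj cov (suc j) = covers-starFam surj (covers-iterStar surj cov j)

  Walk : ℕ → Fin n → Fin n → Set
  Walk l a b = Σ (List (Fin n)) λ xs → length xs ≡ l × applySeq _∗_ a xs ≡ b

  applySeq-++ : ∀ a xs ys → applySeq _∗_ a (xs ++ ys) ≡ applySeq _∗_ (applySeq _∗_ a xs) ys
  applySeq-++ a []       ys = refl
  applySeq-++ a (x ∷ xs) ys = applySeq-++ (a ∗ x) xs ys

  walk-++ : ∀ {i j a b c} → Walk i a b → Walk j b c → Walk (i + j) a c
  walk-++ (xs , refl , refl) (ys , refl , refl) = xs ++ ys , length-++ xs , applySeq-++ _ xs ys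

  walk-multiple : ∀ {l} → (∀ a b → Walk l a b) → ∀ m a b → Walk (suc m * l) a b
  walk-multiple {l} walk zero    a b = subst (λ i → Walk i a b) (sym (+-identityʳ l)) (walk a b)
  walk-multiple     walk (suc m) a b = walk-++ (walk a a) (walk-multiple walk m a b)

  module _ {H : Family n} (∗-inj : ∀ b → Injective _≡_ _≡_ (_∗ b))
           (cov : ∀ j → Covers (iterStar _∗_ j H)) where

    follow-walk : ∀ xs j {P a} → iterStar _∗_ j H P → a ∈ P →
                  ∃ λ P′ → iterStar _∗_ (j + length xs) H P′ × applySeq _∗_ a xs ∈ P′ × ∣ P ∣ ≤ ∣ P′ ∣
    follow-walk []       j {P} hP a∈P = P , subst (λ i → iterStar _∗_ i H P) (sym (+-identityʳ j)) hP , a∈P , ≤-refl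
    follow-walk (x ∷ xs) j {P} hP a∈P with cov j x
    ... | R , hR , x∈R with follow-walk xs (suc j) (P , R , hP , hR , refl) (∈-setOp a∈P x∈R)
    ... | P′ , hP′ , end∈P′ , ∣P∗R∣≤∣P′∣ =
      P′ , subst (λ i → iterStar _∗_ i H P′) (sym (+-suc j (length xs))) hP′ , end∈P′ ,
      ≤-trans (∣p∣≤∣p∗q∣ (∗-inj x) x∈R) ∣P∗R∣≤∣P′∣

blockSize-≤ : ∀ {n} {_∗_ : Op n} {H : Family n} → Ergodic _∗_ → IsPartition H → Periodic _∗_ H →
              ∀ {A C} → H A → H C → ∣ A ∣ ≤ ∣ C ∣
blockSize-≤ _ _ (zero , () , _)
blockSize-≤ {_∗_ = _∗_} {H} (uniform , l , _ , walk) part@(nonempty , _ , covers)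
            (suc k , _ , period) {A} {C} hA hC
  with nonempty A hA | nonempty C hC
... | a , a∈A | c , c∈C with walk-multiple _∗_ walk k a c
... | xs , ∣xs∣≡[1+k]l , xs[a]≡c
  with follow-walk _∗_ (proj₁ ∘ uniform) (covers-iterStar _∗_ (proj₂ ∘ uniform) covers) xs 0 hA a∈A
... | P , hP , end∈P , ∣A∣≤∣P∣ = subst (λ Q → ∣ A ∣ ≤ ∣ Q ∣) P≡C ∣A∣≤∣P∣
  where
  P∈H : H P
  P∈H = iterStar-multiple _∗_ (λ B → Equivalence.to (period B)) l P
          (subst (λ i → iterStar _∗_ i H P) (trans ∣xs∣≡[1+k]l (*-comm (suc k) l)) hP)

  P≡C : P ≡ C
  P≡C = partition-blocks-unique part P∈H hC (subst (_∈ P) xs[a]≡c end∈P) c∈C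

mainTheorem17 : (n : ℕ) (_∗_ : Op n) → Ergodic _∗_ →
    (H : Family n) → IsPartition H → Periodic _∗_ H → Stable _∗_ H
mainTheorem17 n _∗_ erg H part per =
  (λ A B hA hB → ≤-antisym (blockSize-≤ erg part per hA hB) (blockSize-≤ erg part per hB hA)) , per
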